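{- Let $M$ be a minimal dominating set of a finite tree $T$. Then $$|N_1(M)|-\rho_1(M)+|N_2(M)|-\rho_2(M)\le 2(\Gamma(T)-|M|).$$
   Context: A dominating set of a graph $G=(V,E)$ is a set $S\subseteq V$ with $N[S]=V$ ($N[v]$ closed neighbourhood); it is minimal if no proper subset is dominating. $\Gamma(G)$ is the maximum size of a minimal dominating set. For a dominating set $S$: $a(S)=\{u\in S: S\setminus\{u\}\text{ is not dominating}\}$; $N_1(S)=\{u\in V\setminus S: |N[u]\cap S|=1\}$; $N_2(S)=\{u\in V\setminus S:|N[u]\cap S|\ge2\}$; $a_1(S)=\{u\in a(S): N[u]\cap N_1(S)\ne\emptyset\}$; $a_2(S)=\{u\in a(S): N[u]\cap N_1(S)=\emptyset\}$. For a minimal dominating set $M$ of $T$, $\rho_1(M)$ is the maximum size of a matching consisting of edges of $T$ joining a vertex of $N_1(M)$ to a vertex of $a_1(M)$, and $\rho_2(M)$ is the maximum size of a matching consisting of edges of $T$ joining a vertex of $N_2(M)$ to a vertex of $a_2(M)$. -}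

module Defs where

open import Data.Nat using (ℕ; suc; _≤_; _+_; _*_; _∸_; _≡ᵇ_; _≤ᵇ_)
open import Data.Bool using (Bool; true; false; T; _∧_; _∨_; not)
open import Data.Fin using (Fin; _≟_)
open import Data.Fin.Subset using (Subset; _∈_; _∩_; _─_; ⁅_⁆; ∣_∣; _⊂_)
open import Data.Fin.Subset.Properties using (_∈?_)
open import Data.Fin.Properties using (any?; all?)
open import Data.Vec using (tabulate)
open import Data.List using (List; []; _∷_; length; map; _++_; _∷ʳ_)
open import Data.List.Relation.Unary.All using (All)
open import Data.List.Relation.Unary.Linked using (Linked)
open import Data.List.Relation.Unary.Unique.Propositional using (Unique)
open import Data.Product using (Σ; ∃; _×_; _,_; proj₁; proj₂)
open import Relation.Nullary using (¬_; Dec; ⌊_⌋)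
open import Relation.Binary.PropositionalEquality using (_≡_)

record Graph (n : ℕ) : Set where
  field
    adj    : Fin n → Fin n → Bool
    sym    : ∀ u v → adj u v ≡ adj v u
    irrefl : ∀ v → adj v v ≡ false

module _ {n : ℕ} (G : Graph n) where
  open Graph G

  Adj : Fin n → Fin n → Set
  Adj u v = T (adj u v)

  data Walk : Fin n → Fin n → Set where
    here : ∀ {v} → Walk v v
    step : ∀ {u w v} → Adj u w → Walk w v → Walk u v

  Connected : Set
  Connected = ∀ u v → Walk u v

  IsCycle : Fin n → List (Fin n) → Set
  IsCycle x xs = (3 ≤ length (x ∷ xs)) × Unique (x ∷ xs) × Linked Adj ((x ∷ xs) ∷ʳ x)

  Acyclic : Set
  Acyclic = ∀ x xs → ¬ IsCycle x xs

  -- a (finite) tree: nonempty, connected, acyclic graph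
  IsTree : Set
  IsTree = Σ (Fin n) (λ _ → Connected) × Acyclic

  N[_] : Fin n → Subset n
  N[ v ] = tabulate (λ u → ⌊ u ≟ v ⌋ ∨ adj v u)

  nonempty? : Subset n → Bool
  nonempty? S = ⌊ any? (λ x → x ∈? S) ⌋

  Dominating : Subset n → Set
  Dominating S = ∀ v → T (nonempty? (N[ v ] ∩ S))

  dominating? : Subset n → Bool
  dominating? S = ⌊ all? (λ v → Data.Bool.T? (nonempty? (N[ v ] ∩ S))) ⌋
    where import Data.Bool

  MinimalDominating : Subset n → Set
  MinimalDominating S = Dominating S × (∀ S′ → S′ ⊂ S → ¬ Dominating S′)

  IsUpperDomination : ℕ → Set
  IsUpperDomination g =
    (Σ (Subset n) λ D → MinimalDominating D × ∣ D ∣ ≡ g) ×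
    (∀ D → MinimalDominating D → ∣ D ∣ ≤ g)

  a : Subset n → Subset n
  a S = tabulate (λ u → ⌊ u ∈? S ⌋ ∧ not (dominating? (S ─ ⁅ u ⁆)))

  N₁ : Subset n → Subset n
  N₁ S = tabulate (λ u → not ⌊ u ∈? S ⌋ ∧ (∣ N[ u ] ∩ S ∣ ≡ᵇ 1))

  N₂ : Subset n → Subset n
  N₂ S = tabulate (λ u → not ⌊ u ∈? S ⌋ ∧ (2 ≤ᵇ ∣ N[ u ] ∩ S ∣))

  a₁ : Subset n → Subset n
  a₁ S = tabulate (λ u → ⌊ u ∈? a S ⌋ ∧ nonempty? (N[ u ] ∩ N₁ S))

  a₂ : Subset n → Subset n
  a₂ S = tabulate (λ u → ⌊ u ∈? a S ⌋ ∧ not (nonempty? (N[ u ] ∩ N₁ S)))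

  IsMatchingBetween : Subset n → Subset n → List (Fin n × Fin n) → Set
  IsMatchingBetween A B es =
    All (λ e → proj₁ e ∈ A × proj₂ e ∈ B × Adj (proj₁ e) (proj₂ e)) es ×
    Unique (map proj₁ es ++ map proj₂ es)

  IsMaxMatchingSize : Subset n → Subset n → ℕ → Set
  IsMaxMatchingSize A B k =
    (Σ (List (Fin n × Fin n)) λ es → IsMatchingBetween A B es × length es ≡ k) ×
    (∀ es → IsMatchingBetween A B es → length es ≤ k)

  IsRho₁ : Subset n → ℕ → Set
  IsRho₁ M = IsMaxMatchingSize (N₁ M) (a₁ M)

  IsRho₂ : Subset n → ℕ → Set
  IsRho₂ M = IsMaxMatchingSize (N₂ M) (a₂ M)

-- Every vertex of a minimal dominating set M is irredundant, so V splits into M, N₁(M), N₂(M) and M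
-- into a₁(M), a₂(M). Sending each u ∈ a₁ to its private neighbour in N₁ is a matching, whence
-- |a₁| ≤ ρ₁ and |a₁| ≤ |N₁|; and every neighbour of a vertex of a₂ lies in N₂.
-- In a forest one can repeatedly delete a vertex v with at most one remaining neighbour w (together
-- with w): putting v into an independent set I, and the edge vw into a matching between N₂ and a₂
-- whenever one of v, w lies in a₂, gives n + |a₂| ≤ 2|I| + t for a matching of size t ≤ ρ₂, |N₂|.
-- Extending I to a maximal independent set, which is minimal dominating, gives |I| ≤ Γ, and the
-- inequality follows from |M| = |a₁| + |a₂| and n = |M| + |N₁| + |N₂|.
module Submission where

open import Defs
open import Data.Nat using (ℕ; zero; suc; _≤_; _<_; _+_; _*_; _∸_; _≡ᵇ_; _≤ᵇ_; z≤n; s≤s)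
open import Data.Nat.Properties
  using ( ≤-trans; ≤-reflexive; +-suc; +-identityʳ; n≤1+n; m≤n+m; <⇒≱; +-mono-≤; +-monoʳ-≤; ∸-monoʳ-≤
        ; ∸-monoˡ-≤; *-monoʳ-≤; +-cancelʳ-≤; m+n≤o⇒m≤o∸n; *-distribˡ-∸; m+[n∸m]≡n; ≡ᵇ⇒≡; ≡⇒≡ᵇ; ≤ᵇ⇒≤; ≤⇒≤ᵇ
        ; module ≤-Reasoning)
open import Data.Nat.Solver using (module +-*-Solver)
open import Data.Bool using (Bool; T; T?; not)
open import Data.Bool.Properties using (T-≡; T-∧; T-∨)
open import Data.Fin as Fin using (Fin; zero; suc; _≟_)
open import Data.Fin.Properties using (suc-injective; any?; all?; ¬∀⟶∃¬)
open import Data.Fin.Subset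
open import Data.Fin.Subset.Properties renaming (nonempty? to Nonempty?)
open import Data.Fin.Subset.Induction using (⊂-wellFounded; ⊃-wellFounded)
open import Data.Vec.Base using ([]; _∷_; here; there; tabulate)
open import Data.Vec.Properties using (lookup∘tabulate; []=⇒lookup; lookup⇒[]=)
open import Data.List using (List; []; _∷_; _++_; [_]; length; map)
open import Data.List.Properties using (length-map; length-++; map-∘; map-id; ++-assoc)
open import Data.List.Membership.Propositional using () renaming (_∈_ to _∈ₗ_; _∉_ to _∉ₗ_)
open import Data.List.Membership.Propositional.Properties using (∈-map⁻; ∈-++⁻; ∈-∃++)
open import Data.List.Relation.Unary.Any as Any using (here; there)
open import Data.List.Relation.Unary.All as All using (All; []; _∷_)
import Data.List.Relation.Unary.All.Properties as All
open import Data.List.Relation.Unary.Linked using (Linked; []; [-]; _∷_)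
open import Data.List.Relation.Unary.Unique.Propositional using (Unique; []; _∷_)
import Data.List.Relation.Unary.Unique.Propositional.Properties as Unique
open import Data.Product as Product using (∃; _×_; _,_; proj₁; proj₂)
open import Data.Product.Function.NonDependent.Propositional using (_×-⇔_)
open import Data.Sum using (_⊎_; inj₁; inj₂; [_,_]′; map₁)
open import Data.Sum.Function.Propositional using (_⊎-⇔_)
open import Function using (_∘_; id)
open import Function.Bundles using (_⇔_; mk⇔; Equivalence)
open import Function.Construct.Composition using (_⇔-∘_)
open import Function.Construct.Identity using (⇔-id)
open import Induction.WellFounded as WF using (WfRec)
open import Level using (0ℓ)
open import Relation.Nullary using (¬_; Dec; yes; no; ⌊_⌋; contradiction)
open import Relation.Nullary.Decidable
  using (_×-dec_; ¬?; decidable-stable; toWitness; fromWitness; toWitnessFalse; fromWitnessFalse)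
open import Relation.Binary.PropositionalEquality
  using (_≡_; _≢_; refl; sym; trans; cong; cong₂; subst; subst₂; module ≡-Reasoning)

open Equivalence using (to; from)

private
  variable
    n : ℕ
    x y : Fin n
    p q r : Subset n

-- Counting subsets

x∈p-y⇒x≢y : ∀ (p : Subset n) y → x ∈ p - y → x ≢ y
x∈p-y⇒x≢y {x = zero}  (_ ∷ _) _ ()            refl
x∈p-y⇒x≢y {x = suc x} (_ ∷ p) _ (there x∈p-x) refl = x∈p-y⇒x≢y p x x∈p-x refl

x∈p-y⇒x∈p : ∀ (p : Subset n) y → x ∈ p - y → x ∈ p
x∈p-y⇒x∈p p y = p─q⊆p p ⁅ y ⁆

x∈⁅y⁆∪p⁻ : ∀ (p : Subset n) → x ∈ ⁅ y ⁆ ∪ p → x ≡ y ⊎ x ∈ p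
x∈⁅y⁆∪p⁻ {y = y} p = map₁ (x∈⁅y⁆⇒x≡y y) ∘ x∈p∪q⁻ ⁅ y ⁆ p

x∉p⇒p⊂⁅x⁆∪p : x ∉ p → p ⊂ ⁅ x ⁆ ∪ p
x∉p⇒p⊂⁅x⁆∪p {x = x} {p = p} x∉p = q⊆p∪q ⁅ x ⁆ p , x , x∈p∪q⁺ (inj₁ (x∈⁅x⁆ x)) , x∉p

∣p∣≡1+∣p-x∣ : x ∈ p → ∣ p ∣ ≡ suc ∣ p - x ∣
∣p∣≡1+∣p-x∣ {x = zero}  {p = inside ∷ p}  here        = cong (suc ∘ ∣_∣) (sym (p─⊥≡p p))
∣p∣≡1+∣p-x∣ {x = suc x} {p = inside ∷ p}  (there x∈p) = cong suc (∣p∣≡1+∣p-x∣ x∈p)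
∣p∣≡1+∣p-x∣ {x = suc x} {p = outside ∷ p} (there x∈p) = ∣p∣≡1+∣p-x∣ x∈p

x∉p⇒∣⁅x⁆∪p∣≡1+∣p∣ : x ∉ p → ∣ ⁅ x ⁆ ∪ p ∣ ≡ suc ∣ p ∣
x∉p⇒∣⁅x⁆∪p∣≡1+∣p∣ {x = zero}  {p = inside ∷ p}  x∉p = contradiction here x∉p
x∉p⇒∣⁅x⁆∪p∣≡1+∣p∣ {x = zero}  {p = outside ∷ p} x∉p = cong (suc ∘ ∣_∣) (∪-identityˡ p)
x∉p⇒∣⁅x⁆∪p∣≡1+∣p∣ {x = suc x} {p = inside ∷ p}  x∉p = cong suc (x∉p⇒∣⁅x⁆∪p∣≡1+∣p∣ (x∉p ∘ there))
x∉p⇒∣⁅x⁆∪p∣≡1+∣p∣ {x = suc x} {p = outside ∷ p} x∉p = x∉p⇒∣⁅x⁆∪p∣≡1+∣p∣ (x∉p ∘ there)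

p-x⊆q⇒∣p∣≤1+∣q∣ : (∀ {y} → y ∈ p → y ≢ x → y ∈ q) → ∣ p ∣ ≤ suc ∣ q ∣
p-x⊆q⇒∣p∣≤1+∣q∣ {p = p} {x = x} p-x⊆q with x ∈? p
... | yes x∈p = ≤-trans (≤-reflexive (∣p∣≡1+∣p-x∣ x∈p))
                        (s≤s (p⊆q⇒∣p∣≤∣q∣ (λ y∈ → p-x⊆q (x∈p-y⇒x∈p p x y∈) (x∈p-y⇒x≢y p x y∈))))
... | no  x∉p = ≤-trans (p⊆q⇒∣p∣≤∣q∣ (λ y∈p → p-x⊆q y∈p (λ { refl → x∉p y∈p }))) (n≤1+n _)

disjoint⇒∣p∪q∣≡∣p∣+∣q∣ : (∀ {x} → x ∈ p → x ∉ q) → ∣ p ∪ q ∣ ≡ ∣ p ∣ + ∣ q ∣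
disjoint⇒∣p∪q∣≡∣p∣+∣q∣ {p = []}          {q = []}          _    = refl
disjoint⇒∣p∪q∣≡∣p∣+∣q∣ {p = inside ∷ _}  {q = inside ∷ _}  disj = contradiction here (disj here)
disjoint⇒∣p∪q∣≡∣p∣+∣q∣ {p = inside ∷ _}  {q = outside ∷ _} disj =
  cong suc (disjoint⇒∣p∪q∣≡∣p∣+∣q∣ (λ x∈p → disj (there x∈p) ∘ there))
disjoint⇒∣p∪q∣≡∣p∣+∣q∣ {p = outside ∷ p} {q = inside ∷ q}  disj =
  trans (cong suc (disjoint⇒∣p∪q∣≡∣p∣+∣q∣ (λ x∈p → disj (there x∈p) ∘ there))) (sym (+-suc ∣ p ∣ ∣ q ∣))
disjoint⇒∣p∪q∣≡∣p∣+∣q∣ {p = outside ∷ _} {q = outside ∷ _} disj =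
  disjoint⇒∣p∪q∣≡∣p∣+∣q∣ (λ x∈p → disj (there x∈p) ∘ there)

partition⇒∣r∣≡∣p∣+∣q∣ : (∀ {x} → x ∈ p → x ∉ q) → (∀ {x} → x ∈ r → x ∈ p ⊎ x ∈ q) → p ⊆ r → q ⊆ r →
                        ∣ r ∣ ≡ ∣ p ∣ + ∣ q ∣
partition⇒∣r∣≡∣p∣+∣q∣ {p = p} {q = q} disj cover p⊆r q⊆r =
  trans (cong ∣_∣ (⊆-antisym (x∈p∪q⁺ ∘ cover) ([ p⊆r , q⊆r ]′ ∘ x∈p∪q⁻ p q))) (disjoint⇒∣p∪q∣≡∣p∣+∣q∣ disj)

length≤∣p∣ : ∀ {xs} → Unique xs → All (_∈ p) xs → length xs ≤ ∣ p ∣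
length≤∣p∣ []           []            = z≤n
length≤∣p∣ (x∉xs ∷ xs!) (x∈p ∷ xs⊆p) =
  ≤-trans (s≤s (length≤∣p∣ xs! (All.zipWith (λ (x≢y , y∈p) → x∈p∧x≢y⇒x∈p-y y∈p (x≢y ∘ sym)) (x∉xs , xs⊆p))))
          (≤-reflexive (sym (∣p∣≡1+∣p-x∣ x∈p)))

∣p∣≡1⇒x≡y : ∣ p ∣ ≡ 1 → x ∈ p → y ∈ p → x ≡ y
∣p∣≡1⇒x≡y {p = p} {x = x} {y = y} ∣p∣≡1 x∈p y∈p with x ≟ y
... | yes x≡y = x≡y
... | no  x≢y = contradiction (trans (sym ∣p∣≡1) ∣p∣≡2+∣p-x-y∣) λ ()
  where
  ∣p∣≡2+∣p-x-y∣ : ∣ p ∣ ≡ 2 + ∣ p - x - y ∣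
  ∣p∣≡2+∣p-x-y∣ = trans (∣p∣≡1+∣p-x∣ x∈p) (cong suc (∣p∣≡1+∣p-x∣ (x∈p∧x≢y⇒x∈p-y y∈p (x≢y ∘ sym))))

2≤∣p∣⇒∃≢ : 2 ≤ ∣ p ∣ → ∀ x → ∃ λ y → y ∈ p × y ≢ x
2≤∣p∣⇒∃≢ {n} {p} 2≤∣p∣ x with Nonempty? (p - x)
... | yes (y , y∈p-x) = y , x∈p-y⇒x∈p p x y∈p-x , x∈p-y⇒x≢y p x y∈p-x
... | no  p-x≡∅       = contradiction (≤-trans 2≤∣p∣ (p-x⊆q⇒∣p∣≤1+∣q∣ (x∈p∧x≢y⇒x∈p-y {p = p}))) 2≰1+∣p-x∣
  where
  2≰1+∣p-x∣ : ¬ 2 ≤ suc ∣ p - x ∣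
  2≰1+∣p-x∣ rewrite Empty-unique p-x≡∅ | ∣⊥∣≡0 n = λ { (s≤s ()) }

elements : Subset n → List (Fin n)
elements []            = []
elements (inside ∷ p)  = zero ∷ map suc (elements p)
elements (outside ∷ p) = map suc (elements p)

elements⊆ : ∀ (p : Subset n) → All (_∈ p) (elements p)
elements⊆ []            = []
elements⊆ (inside ∷ p)  = here ∷ All.map⁺ (All.map there (elements⊆ p))
elements⊆ (outside ∷ p) = All.map⁺ (All.map there (elements⊆ p))

elements-unique : ∀ (p : Subset n) → Unique (elements p)
elements-unique []            = []
elements-unique (inside ∷ p)  =
  All.map⁺ (All.universal (λ _ ()) _) ∷ Unique.map⁺ suc-injective (elements-unique p)
elements-unique (outside ∷ p) = Unique.map⁺ suc-injective (elements-unique p)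

length-elements : ∀ (p : Subset n) → length (elements p) ≡ ∣ p ∣
length-elements []            = refl
length-elements (inside ∷ p)  = cong suc (trans (length-map Fin.suc (elements p)) (length-elements p))
length-elements (outside ∷ p) = trans (length-map Fin.suc (elements p)) (length-elements p)

module _ {A : Set} where

  Unique-++⁻ˡ : ∀ (xs : List A) {ys} → Unique (xs ++ ys) → Unique xs
  Unique-++⁻ˡ []       _          = []
  Unique-++⁻ˡ (x ∷ xs) (x∉ ∷ xs!) = All.++⁻ˡ xs x∉ ∷ Unique-++⁻ˡ xs xs!

  Unique-insert : ∀ (xs : List A) {z ys} → z ∉ₗ xs ++ ys → Unique (xs ++ ys) → Unique (xs ++ z ∷ ys)
  Unique-insert []       z∉ xs!        = All.¬Any⇒All¬ _ z∉ ∷ xs!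
  Unique-insert (x ∷ xs) z∉ (x∉ ∷ xs!) =
    All.++⁺ (All.++⁻ˡ xs x∉) ((λ x≡z → z∉ (here (sym x≡z))) ∷ All.++⁻ʳ xs x∉) ∷ Unique-insert xs (z∉ ∘ there) xs!

  Unique-map⁺-on : ∀ {B : Set} {P : A → Set} {f : A → B} {xs} → (∀ {x y} → P x → P y → f x ≡ f y → x ≡ y) →
                   All P xs → Unique xs → Unique (map f xs)
  Unique-map⁺-on inj []         []         = []
  Unique-map⁺-on inj (px ∷ pxs) (x∉ ∷ xs!) =
    All.map⁺ (All.zipWith (λ (x≢y , py) fx≡fy → x≢y (inj px py fx≡fy)) (x∉ , pxs)) ∷ Unique-map⁺-on inj pxs xs!

  Linked-replace-tail : ∀ {R : A → A → Set} xs {w z bs} → Linked R (xs ++ w ∷ bs) → R w z →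
                        Linked R (xs ++ w ∷ z ∷ [])
  Linked-replace-tail []           _         wz = wz ∷ [-]
  Linked-replace-tail (x ∷ [])     (xw ∷ _)  wz = xw ∷ wz ∷ [-]
  Linked-replace-tail (x ∷ y ∷ xs) (xy ∷ ys) wz = xy ∷ Linked-replace-tail (y ∷ xs) ys wz

private
  T-⌊⌋ : ∀ {A : Set} {a? : Dec A} → T ⌊ a? ⌋ ⇔ A
  T-⌊⌋ = mk⇔ toWitness fromWitness

  T-not-⌊⌋ : ∀ {A : Set} {a? : Dec A} → T (not ⌊ a? ⌋) ⇔ (¬ A)
  T-not-⌊⌋ = mk⇔ toWitnessFalse fromWitnessFalse

  T-≡ᵇ : ∀ {m k} → T (m ≡ᵇ k) ⇔ (m ≡ k)
  T-≡ᵇ = mk⇔ (≡ᵇ⇒≡ _ _) (≡⇒≡ᵇ _ _)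

  T-≤ᵇ : ∀ {m k} → T (m ≤ᵇ k) ⇔ (m ≤ k)
  T-≤ᵇ = mk⇔ (≤ᵇ⇒≤ _ _) ≤⇒≤ᵇ

  ∈-tabulate : ∀ {f : Fin n → Bool} → x ∈ tabulate f ⇔ T (f x)
  ∈-tabulate {x = x} {f = f} = mk⇔
    (λ x∈ → from T-≡ (trans (sym (lookup∘tabulate f x)) ([]=⇒lookup x∈)))
    (λ fx → lookup⇒[]= x (tabulate f) (trans (lookup∘tabulate f x) (to T-≡ fx)))

module _ {n} (G : Graph n) where
  open Graph G using () renaming (sym to adj-sym; irrefl to adj-irrefl)

  private
    variable
      u v w : Fin n
      S I J : Subset n

  Adj-sym : Adj G u v → Adj G v u
  Adj-sym {u} {v} = subst T (adj-sym u v)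

  Adj⇒≢ : Adj G u v → u ≢ v
  Adj⇒≢ {u} uu refl = subst T (adj-irrefl u) uu

  ∈N[] : u ∈ N[_] G v ⇔ (u ≡ v ⊎ Adj G v u)
  ∈N[] = (T-⌊⌋ ⊎-⇔ ⇔-id _) ⇔-∘ (T-∨ ⇔-∘ ∈-tabulate)

  N[]-refl : v ∈ N[_] G v
  N[]-refl = from ∈N[] (inj₁ refl)

  Adj⇒∈N[] : Adj G v u → u ∈ N[_] G v
  Adj⇒∈N[] = from ∈N[] ∘ inj₂

  N[]-sym : u ∈ N[_] G v → v ∈ N[_] G u
  N[]-sym = from ∈N[] ∘ [ inj₁ ∘ sym , inj₂ ∘ Adj-sym ]′ ∘ to ∈N[]

  private
    T-nonempty? : T (nonempty? G S) ⇔ Nonempty S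
    T-nonempty? = T-⌊⌋

    T-not-nonempty? : T (not (nonempty? G S)) ⇔ (¬ Nonempty S)
    T-not-nonempty? {S} = T-not-⌊⌋ {a? = any? (_∈? S)}

    T-not-dominating? : T (not (dominating? G S)) ⇔ (¬ Dominating G S)
    T-not-dominating? {S} = T-not-⌊⌋ {a? = all? (λ v → T? (nonempty? G (N[_] G v ∩ S)))}

  Dominating⇔ : Dominating G S ⇔ (∀ v → Nonempty (N[_] G v ∩ S))
  Dominating⇔ = mk⇔ (λ dom v → to T-nonempty? (dom v)) (λ dom v → from T-nonempty? (dom v))

  ∈a : u ∈ a G S ⇔ (u ∈ S × ¬ Dominating G (S - u))
  ∈a = (T-⌊⌋ ×-⇔ T-not-dominating?) ⇔-∘ (T-∧ ⇔-∘ ∈-tabulate)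

  ∈N₁ : u ∈ N₁ G S ⇔ (u ∉ S × ∣ N[_] G u ∩ S ∣ ≡ 1)
  ∈N₁ = (T-not-⌊⌋ ×-⇔ T-≡ᵇ) ⇔-∘ (T-∧ ⇔-∘ ∈-tabulate)

  ∈N₂ : u ∈ N₂ G S ⇔ (u ∉ S × 2 ≤ ∣ N[_] G u ∩ S ∣)
  ∈N₂ = (T-not-⌊⌋ ×-⇔ T-≤ᵇ) ⇔-∘ (T-∧ ⇔-∘ ∈-tabulate)

  ∈a₁ : u ∈ a₁ G S ⇔ (u ∈ a G S × Nonempty (N[_] G u ∩ N₁ G S))
  ∈a₁ = (T-⌊⌋ ×-⇔ T-nonempty?) ⇔-∘ (T-∧ ⇔-∘ ∈-tabulate)

  ∈a₂ : u ∈ a₂ G S ⇔ (u ∈ a G S × ¬ Nonempty (N[_] G u ∩ N₁ G S))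
  ∈a₂ = (T-⌊⌋ ×-⇔ T-not-nonempty?) ⇔-∘ (T-∧ ⇔-∘ ∈-tabulate)

  -- Independent sets

  Independent : Subset n → Set
  Independent I = ∀ {x y} → x ∈ I → y ∈ I → ¬ Adj G x y

  Independent-insert : Independent I → (∀ {y} → y ∈ I → ¬ Adj G v y) → Independent (⁅ v ⁆ ∪ I)
  Independent-insert {I} independent v≁I x∈ y∈ xy with x∈⁅y⁆∪p⁻ I x∈ | x∈⁅y⁆∪p⁻ I y∈
  ... | inj₁ refl | inj₁ refl = Adj⇒≢ xy refl
  ... | inj₁ refl | inj₂ y∈I  = v≁I y∈I xy
  ... | inj₂ x∈I  | inj₁ refl = v≁I x∈I (Adj-sym xy)
  ... | inj₂ x∈I  | inj₂ y∈I  = independent x∈I y∈I xy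

  independent-dominating⇒minimal : Independent J → Dominating G J → MinimalDominating G J
  independent-dominating⇒minimal {J} independent dominating = dominating , minimal
    where
    minimal : ∀ S → S ⊂ J → ¬ Dominating G S
    minimal S (S⊆J , x , x∈J , x∉S) S-dominating with to Dominating⇔ S-dominating x
    ... | y , y∈ with x∈p∩q⁻ _ S y∈
    ...   | y∈N[x] , y∈S = [ (λ { refl → x∉S y∈S }) , independent x∈J (S⊆J y∈S) ]′ (to ∈N[] y∈N[x])

  undominated⇒∉ : ¬ Nonempty (N[_] G v ∩ I) → v ∉ I
  undominated⇒∉ v-undominated v∈I = v-undominated (_ , x∈p∩q⁺ (N[]-refl , v∈I))

  undominated⇒≁ : ¬ Nonempty (N[_] G v ∩ I) → y ∈ I → ¬ Adj G v y
  undominated⇒≁ v-undominated y∈I vy = v-undominated (_ , x∈p∩q⁺ (Adj⇒∈N[] vy , y∈I))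

  maximal-independent-superset : Independent I → ∃ λ J → I ⊆ J × Independent J × Dominating G J
  maximal-independent-superset {I} = WF.All.wfRec ⊃-wellFounded 0ℓ Extendable add-undominated I
    where
    Extendable : Subset n → Set
    Extendable I = Independent I → ∃ λ J → I ⊆ J × Independent J × Dominating G J
    add-undominated : ∀ I → WfRec _⊃_ Extendable I → Extendable I
    add-undominated I extend independent with all? (λ v → Nonempty? (N[_] G v ∩ I))
    ... | yes dominated = I , id , independent , from Dominating⇔ dominated
    ... | no ¬dominated with ¬∀⟶∃¬ n _ (λ v → Nonempty? (N[_] G v ∩ I)) ¬dominated
    ...   | v , v-undominated with extend (x∉p⇒p⊂⁅x⁆∪p (undominated⇒∉ v-undominated))
                                         (Independent-insert independent (undominated⇒≁ v-undominated))
    ...     | J , v∪I⊆J , J-independent , J-dominating =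
      J , v∪I⊆J ∘ q⊆p∪q ⁅ v ⁆ I , J-independent , J-dominating

  independent⇒∣I∣≤Γ : ∀ {Γ} → IsUpperDomination G Γ → Independent I → ∣ I ∣ ≤ Γ
  independent⇒∣I∣≤Γ (_ , Γ-max) independent with maximal-independent-superset independent
  ... | J , I⊆J , J-independent , J-dominating =
    ≤-trans (p⊆q⇒∣p∣≤∣q∣ I⊆J) (Γ-max J (independent-dominating⇒minimal J-independent J-dominating))

  -- Matchings

  endpoints : List (Fin n × Fin n) → List (Fin n)
  endpoints es = map proj₁ es ++ map proj₂ es

  EdgesWithin : Subset n → List (Fin n × Fin n) → Set
  EdgesWithin U = All (λ e → proj₁ e ∈ U × proj₂ e ∈ U)

  ∉-endpoints : ∀ {U es} → EdgesWithin U es → v ∉ U → v ∉ₗ endpoints es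
  ∉-endpoints {es = es} es⊆U v∉U v∈ with ∈-++⁻ (map proj₁ es) v∈
  ... | inj₁ v∈₁ with ∈-map⁻ proj₁ v∈₁
  ...   | e , e∈ , refl = v∉U (proj₁ (All.lookup es⊆U e∈))
  ∉-endpoints {es = es} es⊆U v∉U v∈ | inj₂ v∈₂ with ∈-map⁻ proj₂ v∈₂
  ...   | e , e∈ , refl = v∉U (proj₂ (All.lookup es⊆U e∈))

  matching-length≤∣P∣ : ∀ {P Q es} → IsMatchingBetween G P Q es → length es ≤ ∣ P ∣
  matching-length≤∣P∣ {es = es} (edges , es!) = subst (_≤ _) (length-map proj₁ es)
    (length≤∣p∣ (Unique-++⁻ˡ (map proj₁ es) es!) (All.map⁺ (All.map proj₁ edges)))

  ∷-matching : ∀ {P Q es} → u ∈ P → v ∈ Q → Adj G u v → u ∉ₗ endpoints es → v ∉ₗ endpoints es →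
               IsMatchingBetween G P Q es → IsMatchingBetween G P Q ((u , v) ∷ es)
  ∷-matching {es = es} u∈P v∈Q uv u∉ v∉ (edges , es!) =
    (u∈P , v∈Q , uv) ∷ edges ,
    Unique-insert (_ ∷ map proj₁ es) (λ { (here refl) → Adj⇒≢ uv refl ; (there v∈) → v∉ v∈ })
                  (All.¬Any⇒All¬ _ u∉ ∷ es!)

  map-matching : ∀ {P Q us} (f : Fin n → Fin n) → (∀ {x} → x ∈ P → x ∉ Q) →
                 (∀ {u} → u ∈ Q → f u ∈ P × Adj G (f u) u) → (∀ {u v} → u ∈ Q → v ∈ Q → f u ≡ f v → u ≡ v) →
                 Unique us → All (_∈ Q) us → IsMatchingBetween G P Q (map (λ u → f u , u) us)
  map-matching {us = us} f P∩Q=∅ edge injective us! us⊆Q =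
    All.map⁺ (All.map (λ u∈Q → proj₁ (edge u∈Q) , u∈Q , proj₂ (edge u∈Q)) us⊆Q) ,
    subst Unique (sym endpoints≡) (Unique.++⁺ (Unique-map⁺-on injective us⊆Q us!) us! disjoint)
    where
    endpoints≡ : endpoints (map (λ u → f u , u) us) ≡ map f us ++ us
    endpoints≡ = cong₂ _++_ (sym (map-∘ us)) (trans (sym (map-∘ us)) (map-id us))
    disjoint : ∀ {v} → ¬ (v ∈ₗ map f us × v ∈ₗ us)
    disjoint (v∈f[us] , v∈us) with ∈-map⁻ f v∈f[us]
    ... | u , u∈us , refl = P∩Q=∅ (proj₁ (edge (All.lookup us⊆Q u∈us))) (All.lookup us⊆Q v∈us)

  -- Forests

  AtMostOneNeighbour : Subset n → Fin n → Set
  AtMostOneNeighbour U v = ∃ λ p → ∀ {w} → w ∈ U → Adj G v w → w ≡ p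

  next-or-leaf : ∀ U c p → (∃ λ w → w ∈ U × Adj G c w × w ≢ p) ⊎ (∀ {w} → w ∈ U → Adj G c w → w ≡ p)
  next-or-leaf U c p with any? (λ w → w ∈? U ×-dec T? (Graph.adj G c w) ×-dec ¬? (w ≟ p))
  ... | yes next = inj₁ next
  ... | no  ∄next = inj₂ λ {w} w∈U cw → decidable-stable (w ≟ p) (λ w≢p → ∄next (w , w∈U , cw , w≢p))

  revisit⇒cycle : ∀ {c p w rest} → Unique (c ∷ p ∷ rest) → Linked (Adj G) (c ∷ p ∷ rest) → Adj G c w →
                  w ∈ₗ rest → ∃ λ xs → IsCycle G c xs
  revisit⇒cycle {c} {p} {w} path! path cw w∈rest with ∈-∃++ w∈rest
  ... | as , bs , refl = p ∷ as ++ [ w ] , long , unique , linked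
    where
    long : 3 ≤ length (c ∷ p ∷ as ++ [ w ])
    long = s≤s (s≤s (subst (1 ≤_) (sym (length-++ as)) (m≤n+m 1 (length as))))
    unique : Unique (c ∷ p ∷ as ++ [ w ])
    unique = Unique-++⁻ˡ (c ∷ p ∷ as ++ [ w ])
               (subst Unique (cong (λ ys → c ∷ p ∷ ys) (sym (++-assoc as [ w ] bs))) path!)
    linked : Linked (Adj G) (c ∷ p ∷ (as ++ [ w ]) ++ [ c ])
    linked = subst (Linked (Adj G)) (cong (λ ys → c ∷ p ∷ ys) (sym (++-assoc as [ w ] [ c ])))
               (Linked-replace-tail (c ∷ p ∷ as) path (Adj-sym cw))

  module _ (acyclic : Acyclic G) where

    -- Walk through U without backtracking: a revisit closes a cycle and the walk cannot outgrow U,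
    -- so it reaches a vertex with at most one neighbour in U.
    private
      walk : ∀ {U} k c p rest → Unique (c ∷ p ∷ rest) → Linked (Adj G) (c ∷ p ∷ rest) →
             All (_∈ U) (c ∷ p ∷ rest) → ∣ U ∣ < length (c ∷ p ∷ rest) + k →
             ∃ λ v → v ∈ U × AtMostOneNeighbour U v
      walk {U} zero c p rest path! _ path⊆U long =
        contradiction (length≤∣p∣ path! path⊆U) (<⇒≱ (subst (∣ U ∣ <_) (+-identityʳ _) long))
      walk {U} (suc k) c p rest path! path path⊆U@(c∈U ∷ _) long with next-or-leaf U c p
      ... | inj₂ leaf = c , c∈U , p , leaf
      ... | inj₁ (w , w∈U , cw , w≢p) with Any.any? (w ≟_) (c ∷ p ∷ rest)
      ...   | yes (here w≡c)             = contradiction (sym w≡c) (Adj⇒≢ cw)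
      ...   | yes (there (here w≡p))     = contradiction w≡p w≢p
      ...   | yes (there (there w∈rest)) = let xs , cycle = revisit⇒cycle path! path cw w∈rest in
                                             contradiction cycle (acyclic c xs)
      ...   | no  w∉path =
        walk k w c (p ∷ rest) (All.¬Any⇒All¬ _ w∉path ∷ path!) (Adj-sym cw ∷ path) (w∈U ∷ path⊆U)
             (subst (∣ U ∣ <_) (+-suc _ k) long)

    forest-leaf : ∀ {U} → v ∈ U → ∃ λ w → w ∈ U × AtMostOneNeighbour U w
    forest-leaf {v} {U} v∈U with next-or-leaf U v v
    ... | inj₂ leaf = v , v∈U , v , leaf
    ... | inj₁ (w , w∈U , vw , _) =
      walk ∣ U ∣ w v [] (((λ w≡v → Adj⇒≢ vw (sym w≡v)) ∷ []) ∷ [] ∷ []) (Adj-sym vw ∷ [-]) (w∈U ∷ v∈U ∷ [])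
           (s≤s (n≤1+n ∣ U ∣))

private
  bound-step : ∀ μ μ′ e i t → μ ≤ 2 + e + μ′ → μ′ ≤ 2 * i + t → μ ≤ 2 * suc i + (e + t)
  bound-step μ μ′ e i t μ≤ μ′≤ = begin
    μ                     ≤⟨ μ≤ ⟩
    2 + e + μ′            ≤⟨ +-monoʳ-≤ (2 + e) μ′≤ ⟩
    2 + e + (2 * i + t)   ≡⟨ solve 3 (λ e i t → con 2 :+ e :+ (con 2 :* i :+ t)
                                                := con 2 :* (con 1 :+ i) :+ (e :+ t)) refl e i t ⟩
    2 * suc i + (e + t)   ∎
    where
    open ≤-Reasoning
    open +-*-Solver

  +-split-≤ : ∀ k l {a b a′ b′} → a ≡ k + a′ → b ≤ l + b′ → a + b ≤ k + l + (a′ + b′)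
  +-split-≤ k l {b = b} {a′} {b′} refl b≤ = begin
    k + a′ + b         ≤⟨ +-monoʳ-≤ (k + a′) b≤ ⟩
    k + a′ + (l + b′)  ≡⟨ solve 4 (λ k a′ l b′ → k :+ a′ :+ (l :+ b′) := k :+ l :+ (a′ :+ b′)) refl k a′ l b′ ⟩
    k + l + (a′ + b′)  ∎
    where
    open ≤-Reasoning
    open +-*-Solver

module IndependentSetAndMatching {n} (G : Graph n) (acyclic : Acyclic G) {A B : Subset n}
  (A∩B=∅ : ∀ {x} → x ∈ A → x ∉ B) (N[A]⊆B : ∀ {u w} → u ∈ A → Adj G u w → w ∈ B) where

  record Certificate (U : Subset n) : Set where
    field
      I           : Subset n
      I⊆U         : I ⊆ U
      independent : Independent G I
      matching    : List (Fin n × Fin n)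
      isMatching  : IsMatchingBetween G B A matching
      matching⊆U  : EdgesWithin G U matching
      bound       : ∣ U ∣ + ∣ A ∩ U ∣ ≤ 2 * ∣ I ∣ + length matching

  open Certificate

  empty-certificate : ∀ {U} → Empty U → Certificate U
  empty-certificate {U} U≡∅ = record
    { I           = ⊥
    ; I⊆U         = λ x∈⊥ → contradiction x∈⊥ ∉⊥
    ; independent = λ x∈⊥ → contradiction x∈⊥ ∉⊥
    ; matching    = []
    ; isMatching  = [] , []
    ; matching⊆U  = []
    ; bound       = ≤-trans (+-mono-≤ (≤-reflexive ∣U∣≡0) (≤-trans (∣p∩q∣≤∣q∣ A U) (≤-reflexive ∣U∣≡0))) z≤n
    }
    where
    ∣U∣≡0 : ∣ U ∣ ≡ 0
    ∣U∣≡0 = trans (cong ∣_∣ (Empty-unique U≡∅)) (∣⊥∣≡0 n)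

  add-vertex : ∀ {U U′ v} e (c : Certificate U′) (ms : List (Fin n × Fin n)) →
               IsMatchingBetween G B A ms → EdgesWithin G U ms → length ms ≡ e + length (matching c) →
               v ∈ U → v ∉ U′ → U′ ⊆ U → (∀ {y} → y ∈ U′ → ¬ Adj G v y) →
               ∣ U ∣ + ∣ A ∩ U ∣ ≤ 2 + e + (∣ U′ ∣ + ∣ A ∩ U′ ∣) → Certificate U
  add-vertex {U} {U′} {v} e c ms ms-matching ms⊆U ∣ms∣≡ v∈U v∉U′ U′⊆U v≁U′ μ≤ = record
    { I           = ⁅ v ⁆ ∪ I c
    ; I⊆U         = [ (λ { refl → v∈U }) , U′⊆U ∘ I⊆U c ]′ ∘ x∈⁅y⁆∪p⁻ (I c)
    ; independent = Independent-insert G (independent c) (v≁U′ ∘ I⊆U c)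
    ; matching    = ms
    ; isMatching  = ms-matching
    ; matching⊆U  = ms⊆U
    ; bound       = subst₂ (λ i t → _ ≤ 2 * i + t) (sym (x∉p⇒∣⁅x⁆∪p∣≡1+∣p∣ (v∉U′ ∘ I⊆U c))) (sym ∣ms∣≡)
                      (bound-step _ _ e ∣ I c ∣ (length (matching c)) μ≤ (bound c))
    }

  ∣A∩U∣≤∣A∩U′∣ : ∀ {U U′} → (∀ {y} → y ∈ A → y ∈ U → y ∈ U′) → ∣ A ∩ U ∣ ≤ ∣ A ∩ U′ ∣
  ∣A∩U∣≤∣A∩U′∣ {U} U⊆U′ = p⊆q⇒∣p∣≤∣q∣ (λ y∈ → let y∈A , y∈U = x∈p∩q⁻ A U y∈ in x∈p∩q⁺ (y∈A , U⊆U′ y∈A y∈U))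

  ∣A∩U∣≤1+∣A∩U′∣ : ∀ {U U′ x} → (∀ {y} → y ∈ A → y ∈ U → y ≢ x → y ∈ U′) → ∣ A ∩ U ∣ ≤ 1 + ∣ A ∩ U′ ∣
  ∣A∩U∣≤1+∣A∩U′∣ {U} U-x⊆U′ =
    p-x⊆q⇒∣p∣≤1+∣q∣ (λ y∈ y≢x → let y∈A , y∈U = x∈p∩q⁻ A U y∈ in x∈p∩q⁺ (y∈A , U-x⊆U′ y∈A y∈U y≢x))

  add-isolated : ∀ {U v} → v ∈ U → (∀ {y} → y ∈ U → ¬ Adj G v y) → Certificate (U - v) → Certificate U
  add-isolated {U} {v} v∈U v≁U c =
    add-vertex 0 c (matching c) (isMatching c) (All.map (Product.map U-v⊆U U-v⊆U) (matching⊆U c)) refl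
               v∈U (λ v∈ → x∈p-y⇒x≢y U v v∈ refl) U-v⊆U (v≁U ∘ U-v⊆U)
               (+-split-≤ 1 1 (∣p∣≡1+∣p-x∣ v∈U) (∣A∩U∣≤1+∣A∩U′∣ (λ _ → x∈p∧x≢y⇒x∈p-y)))
    where
    U-v⊆U : U - v ⊆ U
    U-v⊆U = x∈p-y⇒x∈p U v

  -- The edge vw joins the matching when v or w lies in A (not both: neighbours of A lie in B).
  add-leaf : ∀ {U v w} → v ∈ U → w ∈ U → Adj G v w → (∀ {y} → y ∈ U → Adj G v y → y ≡ w) →
             Certificate (U - v - w) → Certificate U
  add-leaf {U} {v} {w} v∈U w∈U vw v-leaf c = by-membership-in-A (v ∈? A) (w ∈? A)
    where
    U′ : Subset n
    U′ = U - v - w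
    U′⊆U : U′ ⊆ U
    U′⊆U = x∈p-y⇒x∈p U v ∘ x∈p-y⇒x∈p (U - v) w
    v∉U′ : v ∉ U′
    v∉U′ v∈ = x∈p-y⇒x≢y U v (x∈p-y⇒x∈p (U - v) w v∈) refl
    w∉U′ : w ∉ U′
    w∉U′ w∈ = x∈p-y⇒x≢y (U - v) w w∈ refl
    v≁U′ : ∀ {y} → y ∈ U′ → ¬ Adj G v y
    v≁U′ y∈ vy = x∈p-y⇒x≢y (U - v) w y∈ (v-leaf (U′⊆U y∈) vy)
    ∣U∣≡2+∣U′∣ : ∣ U ∣ ≡ 2 + ∣ U′ ∣
    ∣U∣≡2+∣U′∣ = trans (∣p∣≡1+∣p-x∣ v∈U) (cong suc (∣p∣≡1+∣p-x∣ (x∈p∧x≢y⇒x∈p-y w∈U (Adj⇒≢ G vw ∘ sym))))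
    within : EdgesWithin G U (matching c)
    within = All.map (Product.map U′⊆U U′⊆U) (matching⊆U c)
    ∈U′ : ∀ {y} → y ∈ U → y ≢ v → y ≢ w → y ∈ U′
    ∈U′ y∈U y≢v = x∈p∧x≢y⇒x∈p-y (x∈p∧x≢y⇒x∈p-y y∈U y≢v)
    by-membership-in-A : Dec (v ∈ A) → Dec (w ∈ A) → Certificate U
    by-membership-in-A (yes v∈A) (yes w∈A) = contradiction (N[A]⊆B v∈A vw) (A∩B=∅ w∈A)
    by-membership-in-A (yes v∈A) (no w∉A)  =
      add-vertex 1 c ((w , v) ∷ matching c)
        (∷-matching G (N[A]⊆B v∈A vw) v∈A (Adj-sym G vw)
                    (∉-endpoints G (matching⊆U c) w∉U′) (∉-endpoints G (matching⊆U c) v∉U′) (isMatching c))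
        ((w∈U , v∈U) ∷ within) refl v∈U v∉U′ U′⊆U v≁U′
        (+-split-≤ 2 1 ∣U∣≡2+∣U′∣ (∣A∩U∣≤1+∣A∩U′∣ (λ y∈A y∈U y≢v → ∈U′ y∈U y≢v λ { refl → w∉A y∈A })))
    by-membership-in-A (no v∉A)  (yes w∈A) =
      add-vertex 1 c ((v , w) ∷ matching c)
        (∷-matching G (N[A]⊆B w∈A (Adj-sym G vw)) w∈A vw
                    (∉-endpoints G (matching⊆U c) v∉U′) (∉-endpoints G (matching⊆U c) w∉U′) (isMatching c))
        ((v∈U , w∈U) ∷ within) refl v∈U v∉U′ U′⊆U v≁U′
        (+-split-≤ 2 1 ∣U∣≡2+∣U′∣ (∣A∩U∣≤1+∣A∩U′∣ (λ y∈A y∈U → ∈U′ y∈U λ { refl → v∉A y∈A })))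
    by-membership-in-A (no v∉A)  (no w∉A)  =
      add-vertex 0 c (matching c) (isMatching c) within refl v∈U v∉U′ U′⊆U v≁U′
        (+-split-≤ 2 0 ∣U∣≡2+∣U′∣ (∣A∩U∣≤∣A∩U′∣ (λ y∈A y∈U → ∈U′ y∈U (λ { refl → v∉A y∈A }) λ { refl → w∉A y∈A })))

  certificate : ∀ U → Certificate U
  certificate = WF.All.wfRec ⊂-wellFounded 0ℓ Certificate peel
    where
    peel : ∀ U → WfRec _⊂_ Certificate U → Certificate U
    peel U rec with Nonempty? U
    ... | no  U≡∅       = empty-certificate U≡∅
    ... | yes (_ , x∈U) with forest-leaf G acyclic x∈U
    ...   | v , v∈U , w , v-leaf with w ∈? U ×-dec T? (Graph.adj G v w)
    ...     | yes (w∈U , vw) =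
      add-leaf v∈U w∈U vw v-leaf (rec (⊆-⊂-trans (x∈p-y⇒x∈p (U - v) w) (x∈p⇒p-x⊂p v∈U)))
    ...     | no  v≁w        =
      add-isolated v∈U (λ y∈U vy → v≁w (subst (λ y → y ∈ U × Adj G v y) (v-leaf y∈U vy) (y∈U , vy)))
                   (rec (x∈p⇒p-x⊂p v∈U))

-- Minimal dominating sets

module MinimalDominatingSet {n} (G : Graph n) {M : Subset n} (minimal : MinimalDominating G M) where

  private
    variable
      u v w : Fin n

  dominated : ∀ v → Nonempty (N[_] G v ∩ M)
  dominated = to (Dominating⇔ G) (proj₁ minimal)

  M⊆a : M ⊆ a G M
  M⊆a u∈M = from (∈a G) (u∈M , proj₂ minimal _ (x∈p⇒p-x⊂p u∈M))

  a⊆M : a G M ⊆ M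
  a⊆M = proj₁ ∘ to (∈a G)

  N₁∩M=∅ : x ∈ N₁ G M → x ∉ M
  N₁∩M=∅ = proj₁ ∘ to (∈N₁ G)

  N₂∩M=∅ : x ∈ N₂ G M → x ∉ M
  N₂∩M=∅ = proj₁ ∘ to (∈N₂ G)

  N₁∩N₂=∅ : x ∈ N₁ G M → x ∉ N₂ G M
  N₁∩N₂=∅ x∈N₁ x∈N₂ with proj₂ (to (∈N₁ G) x∈N₁) | proj₂ (to (∈N₂ G) x∈N₂)
  ... | ∣N[x]∩M∣≡1 | 2≤∣N[x]∩M∣ = contradiction (subst (2 ≤_) ∣N[x]∩M∣≡1 2≤∣N[x]∩M∣) λ { (s≤s ()) }

  ∉M⇒N₁⊎N₂ : x ∉ M → x ∈ N₁ G M ⊎ x ∈ N₂ G M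
  ∉M⇒N₁⊎N₂ {x} x∉M with ∣ N[_] G x ∩ M ∣ in ∣N[x]∩M∣≡ | ∣p∣≡1+∣p-x∣ (proj₂ (dominated x))
  ... | zero        | ()
  ... | suc zero    | _ = inj₁ (from (∈N₁ G) (x∉M , ∣N[x]∩M∣≡))
  ... | suc (suc _) | _ = inj₂ (from (∈N₂ G) (x∉M , subst (2 ≤_) (sym ∣N[x]∩M∣≡) (s≤s (s≤s z≤n))))

  ∣M∣+∣N₁∣+∣N₂∣≡n : ∣ M ∣ + ∣ N₁ G M ∣ + ∣ N₂ G M ∣ ≡ n
  ∣M∣+∣N₁∣+∣N₂∣≡n = begin
    ∣ M ∣ + ∣ N₁ G M ∣ + ∣ N₂ G M ∣ ≡⟨ cong (_+ ∣ N₂ G M ∣) (disjoint⇒∣p∪q∣≡∣p∣+∣q∣ M∩N₁=∅) ⟨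
    ∣ M ∪ N₁ G M ∣ + ∣ N₂ G M ∣     ≡⟨ partition⇒∣r∣≡∣p∣+∣q∣ M∪N₁∩N₂=∅ cover ⊆⊤ ⊆⊤ ⟨
    ∣ ⊤ {n} ∣                       ≡⟨ ∣⊤∣≡n n ⟩
    n                               ∎
    where
    open ≡-Reasoning
    M∩N₁=∅ : x ∈ M → x ∉ N₁ G M
    M∩N₁=∅ x∈M x∈N₁ = N₁∩M=∅ x∈N₁ x∈M
    M∪N₁∩N₂=∅ : x ∈ M ∪ N₁ G M → x ∉ N₂ G M
    M∪N₁∩N₂=∅ x∈M∪N₁ x∈N₂ with x∈p∪q⁻ M (N₁ G M) x∈M∪N₁
    ... | inj₁ x∈M  = N₂∩M=∅ x∈N₂ x∈M
    ... | inj₂ x∈N₁ = N₁∩N₂=∅ x∈N₁ x∈N₂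
    cover : x ∈ ⊤ → x ∈ M ∪ N₁ G M ⊎ x ∈ N₂ G M
    cover {x} _ with x ∈? M
    ... | yes x∈M = inj₁ (x∈p∪q⁺ (inj₁ x∈M))
    ... | no  x∉M = map₁ (x∈p∪q⁺ ∘ inj₂) (∉M⇒N₁⊎N₂ x∉M)

  a₁⊆M : a₁ G M ⊆ M
  a₁⊆M = a⊆M ∘ proj₁ ∘ to (∈a₁ G)

  a₂⊆M : a₂ G M ⊆ M
  a₂⊆M = a⊆M ∘ proj₁ ∘ to (∈a₂ G)

  ∣a₁∣+∣a₂∣≡∣M∣ : ∣ a₁ G M ∣ + ∣ a₂ G M ∣ ≡ ∣ M ∣
  ∣a₁∣+∣a₂∣≡∣M∣ = sym (partition⇒∣r∣≡∣p∣+∣q∣ a₁∩a₂=∅ cover a₁⊆M a₂⊆M)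
    where
    a₁∩a₂=∅ : x ∈ a₁ G M → x ∉ a₂ G M
    a₁∩a₂=∅ x∈a₁ x∈a₂ = proj₂ (to (∈a₂ G) x∈a₂) (proj₂ (to (∈a₁ G) x∈a₁))
    cover : x ∈ M → x ∈ a₁ G M ⊎ x ∈ a₂ G M
    cover {x} x∈M with Nonempty? (N[_] G x ∩ N₁ G M)
    ... | yes ne = inj₁ (from (∈a₁ G) (M⊆a x∈M , ne))
    ... | no ¬ne = inj₂ (from (∈a₂ G) (M⊆a x∈M , ¬ne))

  a₂∩N₂=∅ : x ∈ a₂ G M → x ∉ N₂ G M
  a₂∩N₂=∅ x∈a₂ x∈N₂ = N₂∩M=∅ x∈N₂ (a₂⊆M x∈a₂)

  N₁-dominator-unique : y ∈ N₁ G M → u ∈ N[_] G y ∩ M → v ∈ N[_] G y ∩ M → u ≡ v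
  N₁-dominator-unique = ∣p∣≡1⇒x≡y ∘ proj₂ ∘ to (∈N₁ G)

  N[a₂]⊆N₂ : u ∈ a₂ G M → Adj G u w → w ∈ N₂ G M
  N[a₂]⊆N₂ {u} {w} u∈a₂ uw = [ contradiction (Adj⇒∈N[] G uw) ∘ N[u]∩N₁=∅ , id ]′ (∉M⇒N₁⊎N₂ w∉M)
    where
    N[u]∩N₁=∅ : x ∈ N₁ G M → x ∉ N[_] G u
    N[u]∩N₁=∅ x∈N₁ x∈N[u] = proj₂ (to (∈a₂ G) u∈a₂) (_ , x∈p∩q⁺ (x∈N[u] , x∈N₁))
    dominated-without-u : x ∈ N[_] G v ∩ M → x ≢ u → Nonempty (N[_] G v ∩ (M - u))
    dominated-without-u {x} x∈ x≢u with x∈p∩q⁻ _ _ x∈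
    ... | x∈N[v] , x∈M = x , x∈p∩q⁺ (x∈N[v] , x∈p∧x≢y⇒x∈p-y x∈M x≢u)
    -- If w ∈ M then every vertex keeps a dominator other than u, contradicting u ∈ a(M).
    w∉M : w ∉ M
    w∉M w∈M = proj₂ (to (∈a G) (proj₁ (to (∈a₂ G) u∈a₂))) (from (Dominating⇔ G) dominated-by-M-u)
      where
      dominated-by-M-u : ∀ v → Nonempty (N[_] G v ∩ (M - u))
      dominated-by-M-u v with v ∈? M | v ≟ u
      ... | _       | yes refl = dominated-without-u (x∈p∩q⁺ (Adj⇒∈N[] G uw , w∈M)) (Adj⇒≢ G uw ∘ sym)
      ... | yes v∈M | no v≢u   = dominated-without-u (x∈p∩q⁺ (N[]-refl G , v∈M)) v≢u
      ... | no v∉M  | no _     with ∉M⇒N₁⊎N₂ v∉M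
      ...   | inj₂ v∈N₂ = let y , y∈ , y≢u = 2≤∣p∣⇒∃≢ (proj₂ (to (∈N₂ G) v∈N₂)) u in dominated-without-u y∈ y≢u
      ...   | inj₁ v∈N₁ with dominated v
      ...     | y , y∈ = dominated-without-u y∈ λ { refl → N[u]∩N₁=∅ v∈N₁ (N[]-sym G (proj₁ (x∈p∩q⁻ _ _ y∈))) }

  -- The private neighbour of u ∈ a₁ in N₁; the value u elsewhere is never used.
  partner : Fin n → Fin n
  partner u with Nonempty? (N[_] G u ∩ N₁ G M)
  ... | yes (y , _) = y
  ... | no  _       = u

  partner-spec : ∀ {u} → u ∈ a₁ G M → partner u ∈ N₁ G M × Adj G (partner u) u
  partner-spec {u} u∈a₁ with Nonempty? (N[_] G u ∩ N₁ G M)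
  ... | no  ∅       = contradiction (proj₂ (to (∈a₁ G) u∈a₁)) ∅
  ... | yes (y , y∈) with x∈p∩q⁻ _ _ y∈
  ...   | y∈N[u] , y∈N₁ =
    y∈N₁ , [ (λ { refl → contradiction (a₁⊆M u∈a₁) (N₁∩M=∅ y∈N₁) }) , Adj-sym G ]′ (to (∈N[] G) y∈N[u])

  partner-injective : ∀ {u v} → u ∈ a₁ G M → v ∈ a₁ G M → partner u ≡ partner v → u ≡ v
  partner-injective {u} {v} u∈a₁ v∈a₁ same-partner with partner-spec u∈a₁ | partner-spec v∈a₁
  ... | y∈N₁ , yu | _ , y′v =
    N₁-dominator-unique y∈N₁ (x∈p∩q⁺ (Adj⇒∈N[] G yu , a₁⊆M u∈a₁))
      (x∈p∩q⁺ (subst (λ y → v ∈ N[_] G y) (sym same-partner) (Adj⇒∈N[] G y′v) , a₁⊆M v∈a₁))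

  a₁-matching : IsMatchingBetween G (N₁ G M) (a₁ G M) (map (λ u → partner u , u) (elements (a₁ G M)))
  a₁-matching = map-matching G partner (λ x∈N₁ → N₁∩M=∅ x∈N₁ ∘ a₁⊆M) partner-spec partner-injective
                             (elements-unique (a₁ G M)) (elements⊆ (a₁ G M))

  length-a₁-matching : length (map (λ u → partner u , u) (elements (a₁ G M))) ≡ ∣ a₁ G M ∣
  length-a₁-matching = trans (length-map _ (elements (a₁ G M))) (length-elements (a₁ G M))

  ∣a₁∣≤ρ₁ : ∀ {ρ₁} → IsRho₁ G M ρ₁ → ∣ a₁ G M ∣ ≤ ρ₁
  ∣a₁∣≤ρ₁ (_ , ρ₁-max) = subst (_≤ _) length-a₁-matching (ρ₁-max _ a₁-matching)

  ∣a₁∣≤∣N₁∣ : ∣ a₁ G M ∣ ≤ ∣ N₁ G M ∣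
  ∣a₁∣≤∣N₁∣ = subst (_≤ _) length-a₁-matching (matching-length≤∣P∣ G a₁-matching)

combine-bounds : ∀ {n m n₁ n₂ c₁ c₂ i t γ r₁ r₂} → m + n₁ + n₂ ≡ n → c₁ + c₂ ≡ m → n + c₂ ≤ 2 * i + t →
                 c₁ ≤ n₁ → t ≤ n₂ → c₁ ≤ r₁ → t ≤ r₂ → i ≤ γ → (n₁ ∸ r₁) + (n₂ ∸ r₂) ≤ 2 * (γ ∸ m)
combine-bounds {n} {m} {n₁} {n₂} {c₁} {c₂} {i} {t} {γ} {r₁} {r₂}
               partition refl bound c₁≤n₁ t≤n₂ c₁≤r₁ t≤r₂ i≤γ = begin
  (n₁ ∸ r₁) + (n₂ ∸ r₂)  ≤⟨ +-mono-≤ (∸-monoʳ-≤ n₁ c₁≤r₁) (∸-monoʳ-≤ n₂ t≤r₂) ⟩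
  d₁ + d₂                ≤⟨ m+n≤o⇒m≤o∸n (d₁ + d₂) (+-cancelʳ-≤ t _ _ (subst (_≤ 2 * i + t) n+c₂≡ bound)) ⟩
  2 * i ∸ 2 * m          ≡⟨ *-distribˡ-∸ 2 i m ⟨
  2 * (i ∸ m)            ≤⟨ *-monoʳ-≤ 2 (∸-monoˡ-≤ m i≤γ) ⟩
  2 * (γ ∸ m)            ∎
  where
  open ≤-Reasoning
  d₁ d₂ : ℕ
  d₁ = n₁ ∸ c₁
  d₂ = n₂ ∸ t
  n+c₂≡ : n + c₂ ≡ d₁ + d₂ + 2 * m + t
  n+c₂≡ = begin-equality
    n + c₂                                  ≡⟨ cong (_+ c₂) partition ⟨
    m + n₁ + n₂ + c₂                        ≡⟨ cong₂ (λ x y → m + x + y + c₂) (m+[n∸m]≡n c₁≤n₁) (m+[n∸m]≡n t≤n₂) ⟨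
    m + (c₁ + d₁) + (t + d₂) + c₂           ≡⟨ solve 5 (λ c₁ c₂ d₁ d₂ t → (c₁ :+ c₂) :+ (c₁ :+ d₁) :+ (t :+ d₂) :+ c₂
                                                  := d₁ :+ d₂ :+ con 2 :* (c₁ :+ c₂) :+ t) refl c₁ c₂ d₁ d₂ t ⟩
    d₁ + d₂ + 2 * m + t                     ∎
    where open +-*-Solver

theorem14 : ∀ {n} (T : Graph n) → IsTree T →
    ∀ (M : Subset n) → MinimalDominating T M →
    ∀ (Γ ρ₁ ρ₂ : ℕ) → IsUpperDomination T Γ → IsRho₁ T M ρ₁ → IsRho₂ T M ρ₂ →
    (∣ N₁ T M ∣ ∸ ρ₁) + (∣ N₂ T M ∣ ∸ ρ₂) ≤ 2 * (Γ ∸ ∣ M ∣)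
theorem14 {n} T (_ , acyclic) M minimal _ _ _ upper ρ₁-max (_ , ρ₂-max) =
  combine-bounds ∣M∣+∣N₁∣+∣N₂∣≡n ∣a₁∣+∣a₂∣≡∣M∣ n+∣a₂∣≤2∣I∣+t ∣a₁∣≤∣N₁∣ (matching-length≤∣P∣ T isMatching)
                 (∣a₁∣≤ρ₁ ρ₁-max) (ρ₂-max _ isMatching) (independent⇒∣I∣≤Γ T upper independent)
  where
  open MinimalDominatingSet T minimal
  open IndependentSetAndMatching T acyclic a₂∩N₂=∅ N[a₂]⊆N₂
  open Certificate (certificate ⊤)
  n+∣a₂∣≤2∣I∣+t : n + ∣ a₂ T M ∣ ≤ 2 * ∣ I ∣ + length matching
  n+∣a₂∣≤2∣I∣+t =
    subst₂ (λ x y → x + y ≤ 2 * ∣ I ∣ + length matching) (∣⊤∣≡n n) (cong ∣_∣ (∩-identityʳ (a₂ T M))) bound
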